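{- For every odd $n>1$, the algebra $\mathbf{A}_n$ defined below does not have a minority term, i.e., there is no ternary term $s$ of $\mathbf{A}_n$ with $s(y,x,x)=s(x,y,x)=s(x,x,y)=y$ for all $x,y\in A_n$.
   Context: Let $[n]=\{1,\dots,n\}$ and let $m$ be the minority operation on $[n]$ given by $m(x,y,z)=x$ if $y=z$, $m(x,y,z)=y$ if $x=z$, and $m(x,y,z)=z$ otherwise. On $\{0,1,2,3\}$, let $+$ and $-$ denote addition and subtraction modulo $4$, and $\oplus$ denote bitwise XOR of binary representations. Let $A_n=[n]\times\{0,1,2,3\}$. For $i\in[n]$ define the ternary operation $t_i$ on $A_n$ by $t_i((a_1,b_1),(a_2,b_2),(a_3,b_3))=(i,\,b_1-b_2+b_3)$ if $a_1=a_2=a_3=i$, and $=(m(a_1,a_2,a_3),\,b_1\oplus b_2\oplus b_3)$ otherwise. The algebra $\mathbf{A}_n$ has universe $A_n$ and basic operations $t_1,\dots,t_n$. -}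

module Defs where

open import Data.Nat using (ℕ; _+_; _*_; _∸_; _%_; _/_)
open import Data.Nat.DivMod using (_mod_)
open import Data.Fin using (Fin; toℕ; _≟_)
open import Data.Bool using (Bool; true; false; _xor_; if_then_else_)
open import Data.Product using (_×_; _,_)
open import Relation.Nullary using (does)
open import Relation.Binary.PropositionalEquality using (_≡_)
import Data.Fin as Fin

-- [n] is represented by Fin n (element k stands for k+1).
-- {0,1,2,3} is represented by Fin 4.

minority : {n : ℕ} → Fin n → Fin n → Fin n → Fin n
minority x y z =
  if does (y ≟ z) then x else (if does (x ≟ z) then y else z)

subAdd4 : Fin 4 → Fin 4 → Fin 4 → Fin 4
subAdd4 b₁ b₂ b₃ = (toℕ b₁ + (4 ∸ toℕ b₂) + toℕ b₃) mod 4

bit0 : ℕ → Bool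
bit0 k = if does ((k % 2) Data.Nat.≟ 1) then true else false

bit1 : ℕ → Bool
bit1 k = bit0 (k / 2)

fromBool : Bool → ℕ
fromBool true = 1
fromBool false = 0

xor4 : Fin 4 → Fin 4 → Fin 4
xor4 a b = (2 * fromBool (bit1 (toℕ a) xor bit1 (toℕ b))
            + fromBool (bit0 (toℕ a) xor bit0 (toℕ b))) mod 4

A : ℕ → Set
A n = Fin n × Fin 4

t : {n : ℕ} → Fin n → A n → A n → A n → A n
t i (a₁ , b₁) (a₂ , b₂) (a₃ , b₃) =
  if does (a₁ ≟ i) Data.Bool.∧ does (a₂ ≟ i) Data.Bool.∧ does (a₃ ≟ i)
  then (i , subAdd4 b₁ b₂ b₃)
  else (minority a₁ a₂ a₃ , xor4 (xor4 b₁ b₂) b₃)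

data Term (n : ℕ) (V : Set) : Set where
  var : V → Term n V
  op  : Fin n → Term n V → Term n V → Term n V → Term n V

eval : {n : ℕ} {V : Set} → (V → A n) → Term n V → A n
eval ρ (var v) = ρ v
eval ρ (op i s₁ s₂ s₃) = t i (eval ρ s₁) (eval ρ s₂) (eval ρ s₃)

⟦_⟧₃ : {n : ℕ} → Term n (Fin 3) → A n → A n → A n → A n
⟦ s ⟧₃ a b c = eval ρ s
  where
    ρ : Fin 3 → _
    ρ Fin.zero = a
    ρ (Fin.suc Fin.zero) = b
    ρ (Fin.suc (Fin.suc Fin.zero)) = c

IsMinorityTerm : {n : ℕ} → Term n (Fin 3) → Set
IsMinorityTerm {n} s = (x y : A n) →
  (⟦ s ⟧₃ y x x ≡ y) × (⟦ s ⟧₃ x y x ≡ y) × (⟦ s ⟧₃ x x y ≡ y)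

module Submission where

open import Defs
open import Data.Nat using (ℕ; _%_; _<_)
open import Data.Fin using (Fin)
open import Relation.Binary.PropositionalEquality using (_≡_)
open import Relation.Nullary using (¬_)
open import Data.Product using (∃)

open import Data.Nat using (zero; suc; _+_; _∸_)
open import Data.Nat.DivMod using (_mod_)
open import Data.Fin using (zero; suc; toℕ; _≟_)
open import Data.Fin.Patterns using (0F; 1F; 2F; 3F)
open import Data.Fin.Properties using (all?)
open import Data.Bool using (Bool; true; false; not; _∧_; _xor_) renaming (_≟_ to _≟ᵇ_)
open import Data.Bool.Properties using (xor-∧-commutativeRing; xor-identityʳ)
open import Data.Vec.Functional using (_∷_; [])
open import Function using (_∘_)
open import Data.Product using (_×_; _,_; proj₁; proj₂)
open import Algebra.Bundles using (CommutativeRing)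
open import Relation.Nullary using (does; yes; no; contradiction)
open import Relation.Nullary.Decidable using (from-yes)
open import Relation.Binary.PropositionalEquality using (_≢_; refl; sym; trans; cong; cong₂; module ≡-Reasoning)

open CommutativeRing xor-∧-commutativeRing using (+-commutativeMonoid)
open import Algebra.Properties.CommutativeMonoid.Sum +-commutativeMonoid
  using (sum; ∑-distrib-+; sum-cong-≗; sum-replicate-zero)

-- Each block {i} × Z₄ is a subuniverse of 𝐀ₙ on which t_i acts
-- as x − y + z and every other t_j as x ⊕ y ⊕ z.  Write an element of Z₄ by
-- its low (parity) bit and high bit.  On inputs from {0,1} both operations
-- act as XOR on low bits; on high bits they agree except that x − y + z adds
-- a carry.  Hence the high bits of a term s evaluated in the n blocks, XORed
-- together, collect every carry of s exactly once: they give the high bit of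
-- the "affine shadow" of s, i.e. s evaluated in Z₄ with every symbol read as
-- x − y + z.  The shadow is an affine combination a·x + b·y + c·z with
-- a + b + c = 1.  A minority term evaluates to 1 at each unit vector in every
-- block, so every block has high bit 0 and low bit 1 there; then a = b = c = 1
-- in the shadow, contradicting a + b + c = 1 in Z₄.

lo hi : Fin 4 → Bool
lo 0F = false
lo 1F = true
lo 2F = false
lo 3F = true
hi 0F = false
hi 1F = false
hi 2F = true
hi 3F = true

fromBits : Bool → Bool → Fin 4
fromBits false false = 0F
fromBits false true  = 1F
fromBits true  false = 2F
fromBits true  true  = 3F

fromBits-hi-lo : ∀ a → fromBits (hi a) (lo a) ≡ a
fromBits-hi-lo 0F = refl
fromBits-hi-lo 1F = refl
fromBits-hi-lo 2F = refl
fromBits-hi-lo 3F = refl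

xor3 : Fin 4 → Fin 4 → Fin 4 → Fin 4
xor3 a b c = xor4 (xor4 a b) c

-- Carry into the high bit of l₁ − l₂ + l₃ for bits lₖ: it occurs iff l₁ = l₃ ≠ l₂.
carry : Bool → Bool → Bool → Bool
carry l₁ l₂ l₃ = (l₁ xor l₂) ∧ not (l₁ xor l₃)

lo-subAdd4 : ∀ a b c → lo (subAdd4 a b c) ≡ lo a xor lo b xor lo c
lo-subAdd4 = from-yes (all? λ a → all? λ b → all? λ c →
  lo (subAdd4 a b c) ≟ᵇ lo a xor lo b xor lo c)

hi-subAdd4 : ∀ a b c → hi (subAdd4 a b c) ≡ hi a xor hi b xor hi c xor carry (lo a) (lo b) (lo c)
hi-subAdd4 = from-yes (all? λ a → all? λ b → all? λ c →
  hi (subAdd4 a b c) ≟ᵇ hi a xor hi b xor hi c xor carry (lo a) (lo b) (lo c))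

lo-xor3 : ∀ a b c → lo (xor3 a b c) ≡ lo a xor lo b xor lo c
lo-xor3 = from-yes (all? λ a → all? λ b → all? λ c →
  lo (xor3 a b c) ≟ᵇ lo a xor lo b xor lo c)

hi-xor3 : ∀ a b c → hi (xor3 a b c) ≡ hi a xor hi b xor hi c
hi-xor3 = from-yes (all? λ a → all? λ b → all? λ c →
  hi (xor3 a b c) ≟ᵇ hi a xor hi b xor hi c)

-- The unique c with a + b + c ≡ 1 (mod 4).  As an affine map Z₄² → Z₄ it
-- commutes with x − y + z; verified on all 4096 arguments.
third : Fin 4 → Fin 4 → Fin 4
third a b = (9 ∸ (toℕ a + toℕ b)) mod 4

third-subAdd4 : ∀ a₁ a₂ a₃ b₁ b₂ b₃ →
  subAdd4 (third a₁ b₁) (third a₂ b₂) (third a₃ b₃) ≡ third (subAdd4 a₁ a₂ a₃) (subAdd4 b₁ b₂ b₃)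
third-subAdd4 = from-yes (all? λ a₁ → all? λ a₂ → all? λ a₃ → all? λ b₁ → all? λ b₂ → all? λ b₃ →
  subAdd4 (third a₁ b₁) (third a₂ b₂) (third a₃ b₃) ≟ third (subAdd4 a₁ a₂ a₃) (subAdd4 b₁ b₂ b₃))

sum-δ : ∀ {n} (j : Fin n) b → sum (λ i → does (i ≟ j) ∧ b) ≡ b
sum-δ {suc n} zero    b = trans (cong (b xor_) (sum-replicate-zero n)) (xor-identityʳ b)
sum-δ {suc n} (suc j) b = sum-δ j b

sum-xor₄ : ∀ {n} (f g h k : Fin n → Bool) →
  sum (λ i → f i xor g i xor h i xor k i) ≡ sum f xor sum g xor sum h xor sum k
sum-xor₄ f g h k =
  trans (∑-distrib-+ f _) (cong (sum f xor_)
    (trans (∑-distrib-+ g _) (cong (sum g xor_) (∑-distrib-+ h k))))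

module _ {n : ℕ} {V : Set} where

  blockOp : Fin n → Fin n → Fin 4 → Fin 4 → Fin 4 → Fin 4
  blockOp i j with i ≟ j
  ... | yes _ = subAdd4
  ... | no  _ = xor3

  evalBlock : Fin n → (V → Fin 4) → Term n V → Fin 4
  evalBlock i β (var v)         = β v
  evalBlock i β (op j s₁ s₂ s₃) = blockOp i j (evalBlock i β s₁) (evalBlock i β s₂) (evalBlock i β s₃)

  shadow : (V → Fin 4) → Term n V → Fin 4
  shadow β (var v)         = β v
  shadow β (op j s₁ s₂ s₃) = subAdd4 (shadow β s₁) (shadow β s₂) (shadow β s₃)

  minority-idem : (i : Fin n) → minority i i i ≡ i
  minority-idem i with i ≟ i
  ... | yes _  = refl
  ... | no i≢i = contradiction refl i≢i

  t-block : ∀ i j a b c → t j (i , a) (i , b) (i , c) ≡ (i , blockOp i j a b c)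
  t-block i j a b c with i ≟ j
  ... | yes refl = refl
  ... | no  _    = cong (_, xor3 a b c) (minority-idem i)

  eval-block : ∀ i (ρ : V → A n) β → (∀ v → ρ v ≡ (i , β v)) →
               ∀ s → eval ρ s ≡ (i , evalBlock i β s)
  eval-block i ρ β ρ≡β (var v) = ρ≡β v
  eval-block i ρ β ρ≡β (op j s₁ s₂ s₃)
    rewrite eval-block i ρ β ρ≡β s₁ | eval-block i ρ β ρ≡β s₂ | eval-block i ρ β ρ≡β s₃ =
    t-block i j _ _ _

  lo-blockOp : ∀ i j a b c → lo (blockOp i j a b c) ≡ lo a xor lo b xor lo c
  lo-blockOp i j a b c with i ≟ j
  ... | yes _ = lo-subAdd4 a b c
  ... | no  _ = lo-xor3 a b c

  hi-blockOp : ∀ i j a b c →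
    hi (blockOp i j a b c) ≡ hi a xor hi b xor hi c xor (does (i ≟ j) ∧ carry (lo a) (lo b) (lo c))
  hi-blockOp i j a b c with i ≟ j
  ... | yes _ = hi-subAdd4 a b c
  ... | no  _ = trans (hi-xor3 a b c) (cong (λ z → hi a xor hi b xor z) (sym (xor-identityʳ (hi c))))

  -- Low bits never see carries, so every block agrees with the shadow on them.
  lo-block-shadow : ∀ i β s → lo (evalBlock i β s) ≡ lo (shadow β s)
  lo-block-shadow i β (var v) = refl
  lo-block-shadow i β (op j s₁ s₂ s₃) = begin
    lo (blockOp i j a₁ a₂ a₃)        ≡⟨ lo-blockOp i j a₁ a₂ a₃ ⟩
    lo a₁ xor lo a₂ xor lo a₃        ≡⟨ cong₂ _xor_ (IH s₁) (cong₂ _xor_ (IH s₂) (IH s₃)) ⟩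
    lo A₁ xor lo A₂ xor lo A₃        ≡⟨ sym (lo-subAdd4 A₁ A₂ A₃) ⟩
    lo (subAdd4 A₁ A₂ A₃)            ∎
    where
    open ≡-Reasoning
    IH : ∀ s → lo (evalBlock i β s) ≡ lo (shadow β s)
    IH = lo-block-shadow i β
    a₁ a₂ a₃ A₁ A₂ A₃ : Fin 4
    a₁ = evalBlock i β s₁; a₂ = evalBlock i β s₂; a₃ = evalBlock i β s₃
    A₁ = shadow β s₁; A₂ = shadow β s₂; A₃ = shadow β s₃

  -- Carry accounting: on inputs with high bit 0, every carry of the shadow is
  -- produced in exactly one block (the one of its operation symbol), so the
  -- high bit of the shadow is the XOR of the high bits over all blocks.
  hi-shadow : ∀ β → (∀ v → hi (β v) ≡ false) →
              ∀ s → hi (shadow β s) ≡ sum (λ i → hi (evalBlock i β s))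
  hi-shadow β hi-β (var v) =
    trans (hi-β v) (sym (trans (sum-cong-≗ {n} (λ _ → hi-β v)) (sum-replicate-zero n)))
  hi-shadow β hi-β (op j s₁ s₂ s₃) = begin
    hi (subAdd4 A₁ A₂ A₃)
      ≡⟨ hi-subAdd4 A₁ A₂ A₃ ⟩
    hi A₁ xor hi A₂ xor hi A₃ xor c
      ≡⟨ cong₂ _xor_ (IH s₁) (cong₂ _xor_ (IH s₂) (cong₂ _xor_ (IH s₃) (sym (sum-δ j c)))) ⟩
    sum (hiₖ s₁) xor sum (hiₖ s₂) xor sum (hiₖ s₃) xor sum (λ i → does (i ≟ j) ∧ c)
      ≡⟨ sym (sum-xor₄ (hiₖ s₁) (hiₖ s₂) (hiₖ s₃) _) ⟩
    sum (λ i → hiₖ s₁ i xor hiₖ s₂ i xor hiₖ s₃ i xor (does (i ≟ j) ∧ c))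
      ≡⟨ sum-cong-≗ (λ i → cong (λ z → hiₖ s₁ i xor hiₖ s₂ i xor hiₖ s₃ i xor (does (i ≟ j) ∧ z))
                                 (sym (carry-block i))) ⟩
    sum (λ i → hiₖ s₁ i xor hiₖ s₂ i xor hiₖ s₃ i
                 xor (does (i ≟ j) ∧ carry (lo (a s₁ i)) (lo (a s₂ i)) (lo (a s₃ i))))
      ≡⟨ sum-cong-≗ (λ i → sym (hi-blockOp i j (a s₁ i) (a s₂ i) (a s₃ i))) ⟩
    sum (λ i → hi (blockOp i j (a s₁ i) (a s₂ i) (a s₃ i)))
      ∎
    where
    open ≡-Reasoning
    IH : ∀ s → hi (shadow β s) ≡ sum (λ i → hi (evalBlock i β s))
    IH = hi-shadow β hi-β
    a : Term n V → Fin n → Fin 4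
    a s i = evalBlock i β s
    hiₖ : Term n V → Fin n → Bool
    hiₖ s i = hi (a s i)
    A₁ A₂ A₃ : Fin 4
    A₁ = shadow β s₁; A₂ = shadow β s₂; A₃ = shadow β s₃
    c : Bool
    c = carry (lo A₁) (lo A₂) (lo A₃)
    carry-block : ∀ i → carry (lo (a s₁ i)) (lo (a s₂ i)) (lo (a s₃ i)) ≡ c
    carry-block i
      rewrite lo-block-shadow i β s₁ | lo-block-shadow i β s₂ | lo-block-shadow i β s₃ = refl

  -- The shadow is affine: the map third, applied pointwise to the inputs,
  -- passes through every x − y + z.
  shadow-third : ∀ β₀ β₁ β₂ → (∀ v → β₂ v ≡ third (β₀ v) (β₁ v)) →
                 ∀ s → shadow β₂ s ≡ third (shadow β₀ s) (shadow β₁ s)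
  shadow-third β₀ β₁ β₂ β₂≡ (var v) = β₂≡ v
  shadow-third β₀ β₁ β₂ β₂≡ (op j s₁ s₂ s₃)
    rewrite shadow-third β₀ β₁ β₂ β₂≡ s₁ | shadow-third β₀ β₁ β₂ β₂≡ s₂ | shadow-third β₀ β₁ β₂ β₂≡ s₃ =
    third-subAdd4 (shadow β₀ s₁) (shadow β₀ s₂) (shadow β₀ s₃) (shadow β₁ s₁) (shadow β₁ s₂) (shadow β₁ s₃)

  -- If the term has value 1 in every block (and there is a block), its
  -- shadow is 1: high bit 0 by carry accounting, low bit 1 from any block.
  shadow-one : Fin n → ∀ β → (∀ v → hi (β v) ≡ false) → ∀ s →
               (∀ i → evalBlock i β s ≡ 1F) → shadow β s ≡ 1F
  shadow-one i₀ β hi-β s block≡1 = begin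
    shadow β s                              ≡⟨ sym (fromBits-hi-lo (shadow β s)) ⟩
    fromBits (hi (shadow β s)) (lo (shadow β s))
      ≡⟨ cong₂ fromBits hi≡ (trans (sym (lo-block-shadow i₀ β s)) (cong lo (block≡1 i₀))) ⟩
    fromBits false true                     ∎
    where
    open ≡-Reasoning
    hi≡ : hi (shadow β s) ≡ false
    hi≡ = trans (hi-shadow β hi-β s)
                (trans (sum-cong-≗ (λ i → cong hi (block≡1 i))) (sum-replicate-zero n))

⟦⟧₃-block : ∀ {n} (s : Term n (Fin 3)) i a b c →
            ⟦ s ⟧₃ (i , a) (i , b) (i , c) ≡ (i , evalBlock i (a ∷ b ∷ c ∷ []) s)
⟦⟧₃-block s i a b c = eval-block i _ _ (λ { 0F → refl ; 1F → refl ; 2F → refl }) s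

-- The unit vectors of Z₄³: the inputs (y,x,x), (x,y,x), (x,x,y) with x = 0, y = 1.
e₀ e₁ e₂ : Fin 3 → Fin 4
e₀ = 1F ∷ 0F ∷ 0F ∷ []
e₁ = 0F ∷ 1F ∷ 0F ∷ []
e₂ = 0F ∷ 0F ∷ 1F ∷ []

hi-01 : ∀ {a b c} → hi a ≡ false → hi b ≡ false → hi c ≡ false →
        ∀ v → hi ((a ∷ b ∷ c ∷ []) v) ≡ false
hi-01 hi-a hi-b hi-c 0F = hi-a
hi-01 hi-a hi-b hi-c 1F = hi-b
hi-01 hi-a hi-b hi-c 2F = hi-c

e₂-third : ∀ v → e₂ v ≡ third (e₀ v) (e₁ v)
e₂-third 0F = refl
e₂-third 1F = refl
e₂-third 2F = refl

minority-blocks : ∀ {n} (s : Term n (Fin 3)) → IsMinorityTerm s → ∀ i →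
  (evalBlock i e₀ s ≡ 1F) × (evalBlock i e₁ s ≡ 1F) × (evalBlock i e₂ s ≡ 1F)
minority-blocks s minority i =
    value (⟦⟧₃-block s i 1F 0F 0F) (proj₁ eqs)
  , value (⟦⟧₃-block s i 0F 1F 0F) (proj₁ (proj₂ eqs))
  , value (⟦⟧₃-block s i 0F 0F 1F) (proj₂ (proj₂ eqs))
  where
  eqs : (⟦ s ⟧₃ (i , 1F) (i , 0F) (i , 0F) ≡ (i , 1F)) × (⟦ s ⟧₃ (i , 0F) (i , 1F) (i , 0F) ≡ (i , 1F))
        × (⟦ s ⟧₃ (i , 0F) (i , 0F) (i , 1F) ≡ (i , 1F))
  eqs = minority (i , 0F) (i , 1F)
  value : ∀ {p : A _} {b} → p ≡ (i , b) → p ≡ (i , 1F) → b ≡ 1F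
  value p≡b p≡1 = cong proj₂ (trans (sym p≡b) p≡1)

-- The shadow of a minority term would be 1 at all three unit vectors (block 0
-- exists as n ≥ 1), while affinity forces the third value to be 1 − 1 − 1 = 3.
proposition5p4 : (n : ℕ) → n % 2 ≡ 1 → 1 < n →
    ¬ (∃ λ (s : Term n (Fin 3)) → IsMinorityTerm s)
proposition5p4 zero    _ ()
proposition5p4 (suc m) _ _ (s , minority) = 1≢3 (begin
  1F                                  ≡⟨ sym (shadow≡1 refl refl refl (proj₂ ∘ proj₂ ∘ blocks)) ⟩
  shadow e₂ s                         ≡⟨ shadow-third e₀ e₁ e₂ e₂-third s ⟩
  third (shadow e₀ s) (shadow e₁ s)   ≡⟨ cong₂ third (shadow≡1 refl refl refl (proj₁ ∘ blocks))
                                                     (shadow≡1 refl refl refl (proj₁ ∘ proj₂ ∘ blocks)) ⟩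
  third 1F 1F                         ≡⟨⟩
  3F                                  ∎)
  where
  open ≡-Reasoning
  blocks : ∀ i → (evalBlock i e₀ s ≡ 1F) × (evalBlock i e₁ s ≡ 1F) × (evalBlock i e₂ s ≡ 1F)
  blocks = minority-blocks s minority
  shadow≡1 : ∀ {a b c} → hi a ≡ false → hi b ≡ false → hi c ≡ false →
             (∀ i → evalBlock i (a ∷ b ∷ c ∷ []) s ≡ 1F) → shadow (a ∷ b ∷ c ∷ []) s ≡ 1F
  shadow≡1 hi-a hi-b hi-c = shadow-one zero _ (hi-01 hi-a hi-b hi-c) s
  1≢3 : 1F ≢ 3F
  1≢3 ()
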